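{- There is a finitely splitting lim-sup tree-forcing $Q$ (i.e. there are $T_{\max}$ and $\mu$ satisfying the requirements in the context) which is strongly non-homogeneous.
   Context: Trees are subsets of $\omega^{<\omega}$ closed under initial segments; $s\preceq t$ initial segment; $s\perp t$ if incomparable; $\mathrm{Succ}_T(t)$ = immediate successors; branches are maximal chains with $b\restriction n$ the element of length $n$; $T^{[s]}=\{u\in T:u\preceq s\text{ or }s\preceq u\}$. A finitely splitting lim-sup tree-forcing $Q$ is given by a finitely splitting tree $T_{\max}$ and $\mu$ assigning a non-negative real to each subset of $\mathrm{Succ}_{T_{\max}}(t)$, $t\in T_{\max}$, such that $\mu$ is monotone, $\mu(\{s\})<1$ for singletons, and $\limsup_n\mu(\mathrm{Succ}_{T_{\max}}(b\restriction n))=\infty$ along each branch $b$ of $T_{\max}$; with $\mu_T(t)=\mu(\mathrm{Succ}_T(t))$, $Q$ is the set of subtrees $T$ of $T_{\max}$ with $\limsup_n\mu_T(b\restriction n)=\infty$ along each branch of $T$, ordered by inclusion. A subtree $T$ of $T_{\max}$ is $(n,r)$-meager if $\mu_T(t)<r$ for all $t\in T$ of length $\ge n$. $N\rightarrow M$ means: whenever $s_1,\dots,s_M\in T_{\max}$ have length $>N$, $t\in T_{\max}$ with $s_i\perp t$ for all $i$, $A\subseteq\mathrm{Succ}_{T_{\max}}(t)$ with $\mu(A)>N$, and $f_i:A\to T_{\max}^{[s_i]}$ for $1\le i\le M$, there is $B\subseteq A$ with $\mu(B)>M$ such that $\{s\in T_{\max}:\exists i\le M\,\exists t'\in B\ s\preceq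 f_i(t')\}$ is $(N,1/M)$-meager. $Q$ is strongly non-homogeneous if $\mu$ is sub-additive ($\mu(A\cup B)\le\mu(A)+\mu(B)$) and for every $M$ there is $N$ with $N\rightarrow M$. -}

module Defs where

open import Data.Nat as ℕ using (ℕ; zero; suc; _≥_; NonZero)
open import Data.Integer using (+_)
open import Data.Rational using (ℚ; _/_; _<_; _≤_; _+_; 0ℚ; 1ℚ)
open import Data.List using (List; []; _∷_; _∷ʳ_; length; tabulate)
open import Data.List.Relation.Binary.Prefix.Heterogeneous using (Prefix)
open import Data.List.Relation.Binary.Prefix.Heterogeneous.Properties using (prefix?)
open import Data.Fin using (Fin; toℕ)
open import Data.Fin.Properties using (any?)
open import Data.Fin.Subset using (Subset; _∈_; _⊆_; _∪_; ⁅_⁆; ⊤)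
open import Data.Fin.Subset.Properties using (_∈?_)
open import Data.Product using (Σ; ∃; ∃-syntax; _×_; _,_)
open import Data.Sum using (_⊎_)
open import Data.Unit using () renaming (⊤ to Unit)
open import Relation.Nullary using (¬_; Dec; does; _×-dec_; _⊎-dec_)
open import Relation.Binary.PropositionalEquality using (_≡_)
import Data.Nat.Properties as ℕP
import Data.Vec as Vec

Seq : Set
Seq = List ℕ

_⪯_ : Seq → Seq → Set
s ⪯ t = Prefix _≡_ s t

_⪯?_ : (s t : Seq) → Dec (s ⪯ t)
s ⪯? t = prefix? ℕP._≟_ s t

_⊥_ : Seq → Seq → Set
s ⊥ t = ¬ (s ⪯ t) × ¬ (t ⪯ s)

-- A finitely splitting tree T_max ⊆ ω^{<ω} is presented by its splitting
-- function: the immediate successors of a node t are t ⌢ k for k < split t.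
Splitting : Set
Splitting = Seq → ℕ

inTree' : Splitting → Seq → Seq → Set
inTree' sp p []       = Unit
inTree' sp p (x ∷ xs) = (x ℕ.< sp p) × inTree' sp (p ∷ʳ x) xs

InTree : Splitting → Seq → Set
InTree sp t = inTree' sp [] t

restr : (ℕ → ℕ) → ℕ → Seq
restr b n = tabulate {n = n} (λ i → b (toℕ i))

Branch : Splitting → (ℕ → ℕ) → Set
Branch sp b = ∀ n → b n ℕ.< sp (restr b n)

-- μ assigns to each subset of Succ_{T_max}(t) (a subset of Fin (split t),
-- k ↦ t ⌢ k) a rational number.
Measure : Splitting → Set
Measure sp = (t : Seq) → Subset (sp t) → ℚ

ℕtoℚ : ℕ → ℚ
ℕtoℚ n = + n / 1

record IsLimSupTreeForcing (sp : Splitting) (μ : Measure sp) : Set where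
  field
    pruned      : ∀ t → InTree sp t → NonZero (sp t)
    nonneg      : ∀ t → InTree sp t → (A : Subset (sp t)) → 0ℚ ≤ μ t A
    monotone    : ∀ t → InTree sp t → (A B : Subset (sp t)) → A ⊆ B → μ t A ≤ μ t B
    singleton   : ∀ t → InTree sp t → (k : Fin (sp t)) → μ t ⁅ k ⁆ < 1ℚ
    limsup-∞    : ∀ b → Branch sp b → ∀ (K n : ℕ) →
                    ∃[ m ] (m ≥ n × ℕtoℚ K < μ (restr b m) ⊤)

SuccOf : (sp : Splitting) (S : Seq → Set) → (∀ s → Dec (S s)) → (t : Seq) → Subset (sp t)
SuccOf sp S S? t = Vec.tabulate (λ k → does (S? (t ∷ʳ toℕ k)))

Meager : (sp : Splitting) (μ : Measure sp) (S : Seq → Set) → (∀ s → Dec (S s)) → ℕ → ℚ → Set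
Meager sp μ S S? n r = ∀ t → S t → length t ≥ n → μ t (SuccOf sp S S? t) < r

Generated : (M : ℕ) (k : ℕ) (B : Subset k) (f : Fin M → Fin k → Seq) → Seq → Set
Generated M k B f s = ∃[ i ] ∃[ t' ] (t' ∈ B × s ⪯ f i t')

Generated? : (M : ℕ) (k : ℕ) (B : Subset k) (f : Fin M → Fin k → Seq) → ∀ s → Dec (Generated M k B f s)
Generated? M k B f s = any? (λ i → any? (λ t' → (t' ∈? B) ×-dec (s ⪯? f i t')))

-- N → M  (M ≥ 1, so that 1/M makes sense).
Arrow : (sp : Splitting) (μ : Measure sp) (N M : ℕ) → .{{NonZero M}} → Set
Arrow sp μ N M =
  (s : Fin M → Seq) → (∀ i → InTree sp (s i) × length (s i) ℕ.> N) →
  (t : Seq) → InTree sp t → (∀ i → s i ⊥ t) →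
  (A : Subset (sp t)) → ℕtoℚ N < μ t A →
  -- f_i : A → T_max^{[s_i]} (values outside A are irrelevant)
  (f : Fin M → Fin (sp t) → Seq) →
  (∀ i k → k ∈ A → InTree sp (f i k) × (f i k ⪯ s i ⊎ s i ⪯ f i k)) →
  ∃[ B ] (B ⊆ A × ℕtoℚ M < μ t B ×
          Meager sp μ (Generated M (sp t) B f) (Generated? M (sp t) B f) N (+ 1 / M))

record StronglyNonHomogeneous (sp : Splitting) (μ : Measure sp) : Set where
  field
    subadditive : ∀ t → InTree sp t → (A B : Subset (sp t)) → μ t (A ∪ B) ≤ μ t A + μ t B
    arrow       : ∀ M → .{{_ : NonZero M}} → ∃[ N ] Arrow sp μ N M

module Submission where

-- At each length ℓ at most one node of the tree splits, namely active ℓ, into width ℓ = base ℓ ^ (ℓ (ℓ + 2))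
-- successors; every other node has the single successor 0. Every finite sequence is an initial segment
-- of active ℓ for arbitrarily large ℓ, so every branch passes through infinitely many splitting nodes.
-- A set of successors of a node of length ℓ is measured by its number of base-(base ℓ) digits divided
-- by ℓ + 2: this is subadditive, at most 1 / (ℓ + 2) on sets of fewer than base ℓ elements, and larger
-- than ℓ on all successors of a splitting node.
--
-- For N → M take N = 2M. If μ_t(A) > N then t splits and |A| has more than N (ℓ + 2) digits. Grouping the
-- x ∈ A by the truncations to length ℓ of f_1(x), …, f_M(x), of which there are at most base ℓ ^ M,
-- yields a class B with at most M digits fewer, so μ_t(B) > M. A node u of length ≥ N generated from B
-- has at most M successors there if it is shorter than t (they are read off the common truncations), at
-- most M · width ℓ if it is longer, and one if it has the length of t (it is not t, as every s_i ⊥ t);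
-- each bound is below base (length u), so μ_u < 1 / M.

open import Defs

open import Data.Bool using (if_then_else_)
open import Data.Fin as Fin using (Fin; toℕ; fromℕ<; combine; remQuot)
open import Data.Fin.Properties using (toℕ-fromℕ<; toℕ-injective; toℕ<n; remQuot-combine)
open import Data.Fin.Subset using (Subset; _∈_; _⊆_; _∪_; _∩_; ⁅_⁆; ⊤; ⋃; ∣_∣; inside; outside) renaming (⊥ to ∅)
open import Data.Fin.Subset.Properties
  using (∣⊥∣≡0; ∣⊤∣≡n; ∣p∣≤n; ∣⁅x⁆∣≡1; x∈⁅x⁆; x∈p∪q⁺; x∈p∩q⁺; x∈p∩q⁻; p⊆q⇒∣p∣≤∣q∣)
open import Data.Integer as ℤ using (+_; +≤+; +<+)
import Data.Integer.Properties as ℤ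
open import Data.Integer.Tactic.RingSolver using (solve-∀)
open import Data.List using (List; []; _∷_; _∷ʳ_; _++_; length; map; concatMap; upTo; take; replicate)
open import Data.List.Properties
  using (≡-dec; length-map; length-upTo; length-++; length-take; length-tabulate; ++-identityʳ; ++-assoc; take-all)
open import Data.List.Membership.Propositional using (lose) renaming (_∈_ to _∈ˡ_)
open import Data.List.Membership.Propositional.Properties using (∈-concatMap⁺; ∈-map⁺; ∈-upTo⁺)
open import Data.List.Relation.Binary.Prefix.Heterogeneous using ([]; _∷_)
import Data.List.Relation.Binary.Prefix.Heterogeneous.Properties as Prefix
open import Data.List.Relation.Unary.All using (All; []; _∷_)
open import Data.List.Relation.Unary.Any using (here; there)
open import Data.Nat hiding (_/_)
open import Data.Nat.Binary as ℕᵇ using (ℕᵇ; 2[1+_]; 1+[2_])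
import Data.Nat.Binary.Properties as ℕᵇ
open import Data.Nat.Properties
open import Data.Product using (Σ; ∃-syntax; _×_; _,_; proj₁; proj₂; uncurry)
open import Data.Rational as ℚ using (_/_; 0ℚ; 1ℚ)
import Data.Rational.Properties as ℚ
import Data.Rational.Unnormalised as ℚᵘ
import Data.Rational.Unnormalised.Properties as ℚᵘ
open import Data.Sum using (_⊎_; inj₁; inj₂)
open import Data.Vec using ([]; _∷_; tabulate)
import Data.Vec.Functional as Vector
open import Data.Vec.Properties using ([]=⇒lookup; lookup⇒[]=; lookup∘tabulate)
open import Function using (_∘_)
open import Relation.Binary.Definitions using (DecidableEquality; Tri; tri<; tri≈; tri>)
open import Relation.Binary.PropositionalEquality
open import Relation.Nullary using (Dec; yes; no; does; ¬_; contradiction)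
open import Relation.Nullary.Decidable using (dec-true; dec-false)

-- Base-β digits

m+n<o*p : ∀ {m n o p} → m < o → n < p → m + n < o * p
m+n<o*p {m} {n} {o} {p} m<o n<p = begin-strict
  m + n     <⟨ +-monoʳ-< m n<p ⟩
  m + p     ≤⟨ +-monoˡ-≤ p (m≤m*n m p {{>-nonZero (≤-<-trans z≤n n<p)}}) ⟩
  m * p + p ≡⟨ +-comm (m * p) p ⟩
  suc m * p ≤⟨ *-monoˡ-≤ p m<o ⟩
  o * p     ∎
  where open ≤-Reasoning

digitsFrom : (β x r fuel : ℕ) → ℕ
digitsFrom β x r zero       = r
digitsFrom β x r (suc fuel) with x <? β ^ r
... | yes _ = r
... | no  _ = digitsFrom β x (suc r) fuel

-- The least r with x < β ^ r; the search needs at most x steps as x < β ^ x.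
digits : (β x : ℕ) → ℕ
digits β x = digitsFrom β x 0 x

module _ {β : ℕ} (1<β : 1 < β) where

  private instance
    β-nonZero : NonZero β
    β-nonZero = >-nonZero (<-trans z<s 1<β)

  n<β^n : ∀ n → n < β ^ n
  n<β^n zero    = z<s
  n<β^n (suc n) = begin-strict
    suc n         ≤⟨ n<β^n n ⟩
    β ^ n         <⟨ m<m+n (β ^ n) (m^n>0 β n) ⟩
    β ^ n + β ^ n ≡⟨ cong (_+_ (β ^ n)) (sym (+-identityʳ (β ^ n))) ⟩
    2 * β ^ n     ≤⟨ *-monoˡ-≤ (β ^ n) 1<β ⟩
    β ^ suc n     ∎
    where open ≤-Reasoning

  digitsFrom-least : ∀ x r fuel → (∀ i → i < r → β ^ i ≤ x) → x < β ^ (r + fuel) →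
                     x < β ^ digitsFrom β x r fuel × (∀ i → i < digitsFrom β x r fuel → β ^ i ≤ x)
  digitsFrom-least x r zero below x< = subst (λ e → x < β ^ e) (+-identityʳ r) x< , below
  digitsFrom-least x r (suc fuel) below x< with x <? β ^ r
  ... | yes x<β^r = x<β^r , below
  ... | no  x≮β^r = digitsFrom-least x (suc r) fuel below′ (subst (λ e → x < β ^ e) (+-suc r fuel) x<)
    where
    below′ : ∀ i → i < suc r → β ^ i ≤ x
    below′ i i<1+r with m≤n⇒m<n∨m≡n (s≤s⁻¹ i<1+r)
    ... | inj₁ i<r  = below i i<r
    ... | inj₂ refl = ≮⇒≥ x≮β^r

  <β^digits : ∀ x → x < β ^ digits β x
  <β^digits x = proj₁ (digitsFrom-least x 0 x (λ _ ()) (n<β^n x))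

  <β^⇒digits≤ : ∀ {x r} → x < β ^ r → digits β x ≤ r
  <β^⇒digits≤ {x} {r} x<β^r with digits β x ≤? r
  ... | yes d≤r = d≤r
  ... | no  d≰r = contradiction x<β^r (≤⇒≯ (proj₂ (digitsFrom-least x 0 x (λ _ ()) (n<β^n x)) r (≰⇒> d≰r)))

  digits≤⇒<β^ : ∀ {x r} → digits β x ≤ r → x < β ^ r
  digits≤⇒<β^ {x} d≤r = <-≤-trans (<β^digits x) (^-monoʳ-≤ β d≤r)

  β^≤⇒<digits : ∀ {x r} → β ^ r ≤ x → r < digits β x
  β^≤⇒<digits β^r≤x = ≰⇒> (λ d≤r → ≤⇒≯ β^r≤x (digits≤⇒<β^ d≤r))

  <digits⇒β^≤ : ∀ {x r} → r < digits β x → β ^ r ≤ x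
  <digits⇒β^≤ r<d = ≮⇒≥ (λ x<β^r → ≤⇒≯ (<β^⇒digits≤ x<β^r) r<d)

  digits-β^* : ∀ m y → digits β (β ^ m * y) ≤ m + digits β y
  digits-β^* m y = <β^⇒digits≤ (subst (β ^ m * y <_) (sym (^-distribˡ-+-* β m (digits β y)))
                                      (*-monoʳ-< (β ^ m) {{m^n≢0 β m}} (<β^digits y)))

  digits-mono-≤ : ∀ {x y} → x ≤ y → digits β x ≤ digits β y
  digits-mono-≤ {y = y} x≤y = <β^⇒digits≤ (≤-<-trans x≤y (<β^digits y))

  digits-<β : ∀ {x} → x < β → digits β x ≤ 1
  digits-<β x<β = <β^⇒digits≤ (subst (_ <_) (sym (*-identityʳ β)) x<β)

  digits-+ : ∀ x y → digits β (x + y) ≤ digits β x + digits β y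
  digits-+ x y = <β^⇒digits≤ (subst (x + y <_) (sym (^-distribˡ-+-* β (digits β x) (digits β y)))
                                     (m+n<o*p (<β^digits x) (<β^digits y)))

-- Fractions

toℚᵘ-/ : ∀ a d → ℚ.toℚᵘ (+ a / suc d) ℚᵘ.≃ ℚᵘ.mkℚᵘ (+ a) d
toℚᵘ-/ a d = ℚ.toℚᵘ-fromℚᵘ (ℚᵘ.mkℚᵘ (+ a) d)

/-≤ : ∀ a b d e → a * suc e ≤ b * suc d → + a / suc d ℚ.≤ + b / suc e
/-≤ a b d e le = ℚ.toℚᵘ-cancel-≤
  (ℚᵘ.≤-respʳ-≃ (ℚᵘ.≃-sym (toℚᵘ-/ b e)) (ℚᵘ.≤-respˡ-≃ (ℚᵘ.≃-sym (toℚᵘ-/ a d))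
    (ℚᵘ.*≤* (subst₂ ℤ._≤_ (ℤ.pos-* a (suc e)) (ℤ.pos-* b (suc d)) (+≤+ le)))))

/-< : ∀ a b d e → a * suc e < b * suc d → + a / suc d ℚ.< + b / suc e
/-< a b d e lt = ℚ.toℚᵘ-cancel-<
  (ℚᵘ.<-respʳ-≃ (ℚᵘ.≃-sym (toℚᵘ-/ b e)) (ℚᵘ.<-respˡ-≃ (ℚᵘ.≃-sym (toℚᵘ-/ a d))
    (ℚᵘ.*<* (subst₂ ℤ._<_ (ℤ.pos-* a (suc e)) (ℤ.pos-* b (suc d)) (+<+ lt)))))

/-<⁻¹ : ∀ a b d e → + a / suc d ℚ.< + b / suc e → a * suc e < b * suc d
/-<⁻¹ a b d e lt with ℚᵘ.<-respʳ-≃ (toℚᵘ-/ b e) (ℚᵘ.<-respˡ-≃ (toℚᵘ-/ a d) (ℚ.toℚᵘ-mono-< lt))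
... | ℚᵘ.*<* ab<ba = ℤ.drop‿+<+ (subst₂ ℤ._<_ (sym (ℤ.pos-* a (suc e))) (sym (ℤ.pos-* b (suc d))) ab<ba)

mkℚᵘ-+ : ∀ a c d → ℚᵘ.mkℚᵘ (+ a) d ℚᵘ.+ ℚᵘ.mkℚᵘ (+ c) d ℚᵘ.≃ ℚᵘ.mkℚᵘ (+ (a + c)) d
mkℚᵘ-+ a c d = ℚᵘ.*≡* (trans (ring (+ a) (+ c) (+ suc d)) (cong (ℤ._* (+ suc d ℤ.* + suc d)) (sym (ℤ.pos-+ a c))))
  where
  ring : ∀ (a c e : ℤ.ℤ) → (a ℤ.* e ℤ.+ c ℤ.* e) ℤ.* e ≡ (a ℤ.+ c) ℤ.* (e ℤ.* e)
  ring = solve-∀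

/-subadditive : ∀ x a c d → x ≤ a + c → + x / suc d ℚ.≤ + a / suc d ℚ.+ + c / suc d
/-subadditive x a c d x≤a+c =
  ℚ.toℚᵘ-cancel-≤ (ℚᵘ.≤-respʳ-≃ (ℚᵘ.≃-sym sum) (ℚ.toℚᵘ-mono-≤ (/-≤ x (a + c) d d (*-monoˡ-≤ (suc d) x≤a+c))))
  where
  sum : ℚ.toℚᵘ (+ a / suc d ℚ.+ + c / suc d) ℚᵘ.≃ ℚ.toℚᵘ (+ (a + c) / suc d)
  sum = ℚᵘ.≃-trans (ℚ.toℚᵘ-homo-+ (+ a / suc d) (+ c / suc d))
        (ℚᵘ.≃-trans (ℚᵘ.+-cong (toℚᵘ-/ a d) (toℚᵘ-/ c d)) (ℚᵘ.≃-trans (mkℚᵘ-+ a c d) (ℚᵘ.≃-sym (toℚᵘ-/ (a + c) d))))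

-- Counting subsets of Fin n

∣p∪q∣≤∣p∣+∣q∣ : ∀ {n} (p q : Subset n) → ∣ p ∪ q ∣ ≤ ∣ p ∣ + ∣ q ∣
∣p∪q∣≤∣p∣+∣q∣ []            []            = z≤n
∣p∪q∣≤∣p∣+∣q∣ (inside ∷ p)  (inside ∷ q)  = s≤s (≤-trans (∣p∪q∣≤∣p∣+∣q∣ p q) (+-monoʳ-≤ ∣ p ∣ (n≤1+n ∣ q ∣)))
∣p∪q∣≤∣p∣+∣q∣ (inside ∷ p)  (outside ∷ q) = s≤s (∣p∪q∣≤∣p∣+∣q∣ p q)
∣p∪q∣≤∣p∣+∣q∣ (outside ∷ p) (inside ∷ q)  = ≤-trans (s≤s (∣p∪q∣≤∣p∣+∣q∣ p q)) (≤-reflexive (sym (+-suc ∣ p ∣ ∣ q ∣)))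
∣p∪q∣≤∣p∣+∣q∣ (outside ∷ p) (outside ∷ q) = ∣p∪q∣≤∣p∣+∣q∣ p q

∈tabulate⁺ : ∀ {n p} {P : Fin n → Set p} (P? : ∀ x → Dec (P x)) {x} → P x → x ∈ tabulate (does ∘ P?)
∈tabulate⁺ P? {x} px = lookup⇒[]= x _ (trans (lookup∘tabulate (does ∘ P?) x) (dec-true (P? x) px))

∈tabulate⁻ : ∀ {n p} {P : Fin n → Set p} (P? : ∀ x → Dec (P x)) {x} → x ∈ tabulate (does ∘ P?) → P x
∈tabulate⁻ P? {x} x∈ with P? x | trans (sym (lookup∘tabulate (does ∘ P?) x)) ([]=⇒lookup x∈)
... | yes px | _ = px
... | no  _  | ()

ℕ-singleton : ∀ {n} → ℕ → Subset n
ℕ-singleton {n} m with m <? n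
... | yes m<n = ⁅ fromℕ< m<n ⁆
... | no  _   = ∅

∣ℕ-singleton∣≤1 : ∀ {n} m → ∣ ℕ-singleton {n} m ∣ ≤ 1
∣ℕ-singleton∣≤1 {n} m with m <? n
... | yes m<n = ≤-reflexive (∣⁅x⁆∣≡1 (fromℕ< m<n))
... | no  _   = ≤-trans (≤-reflexive (∣⊥∣≡0 n)) z≤n

∈ℕ-singleton : ∀ {n} (k : Fin n) → k ∈ ℕ-singleton (toℕ k)
∈ℕ-singleton {n} k with toℕ k <? n
... | yes k<n = subst (_∈ ⁅ fromℕ< k<n ⁆) (toℕ-injective (toℕ-fromℕ< k<n)) (x∈⁅x⁆ (fromℕ< k<n))
... | no  k≮n = contradiction (toℕ<n k) k≮n

imageℕ : ∀ {n c} → (Fin c → ℕ) → Subset n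
imageℕ {c = zero}  e = ∅
imageℕ {c = suc c} e = ℕ-singleton (e Fin.zero) ∪ imageℕ (e ∘ Fin.suc)

∣imageℕ∣≤ : ∀ {n c} (e : Fin c → ℕ) → ∣ imageℕ {n} e ∣ ≤ c
∣imageℕ∣≤ {n} {zero}  e = ≤-reflexive (∣⊥∣≡0 n)
∣imageℕ∣≤ {n} {suc c} e = ≤-trans (∣p∪q∣≤∣p∣+∣q∣ (ℕ-singleton {n} (e Fin.zero)) (imageℕ (e ∘ Fin.suc)))
                                   (+-mono-≤ (∣ℕ-singleton∣≤1 {n} (e Fin.zero)) (∣imageℕ∣≤ (e ∘ Fin.suc)))

∈imageℕ : ∀ {n c} (e : Fin c → ℕ) {k : Fin n} j → e j ≡ toℕ k → k ∈ imageℕ e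
∈imageℕ e {k} Fin.zero ej≡k = x∈p∪q⁺ (inj₁ (subst (λ m → k ∈ ℕ-singleton m) (sym ej≡k) (∈ℕ-singleton k)))
∈imageℕ e (Fin.suc j) ej≡k = x∈p∪q⁺ (inj₂ (∈imageℕ (e ∘ Fin.suc) j ej≡k))

∈⋃⁺ : ∀ {n} {X : Set} (F : X → Subset n) {x : Fin n} {v} vs → v ∈ˡ vs → x ∈ F v → x ∈ ⋃ (map F vs)
∈⋃⁺ F (w ∷ vs) (here refl) x∈Fv = x∈p∪q⁺ (inj₁ x∈Fv)
∈⋃⁺ F (w ∷ vs) (there v∈) x∈Fv = x∈p∪q⁺ (inj₂ (∈⋃⁺ F vs v∈ x∈Fv))

∣⋃∣≤length*largest : ∀ {n} {X : Set} (F : X → Subset n) → X → ∀ vs →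
                     ∃[ v ] ∣ ⋃ (map F vs) ∣ ≤ length vs * ∣ F v ∣
∣⋃∣≤length*largest {n} F v₀ [] = v₀ , ≤-reflexive (∣⊥∣≡0 n)
∣⋃∣≤length*largest F v₀ (w ∷ vs) with ∣⋃∣≤length*largest F v₀ vs
... | v , ⋃≤ with ∣ F w ∣ ≤? ∣ F v ∣
...   | yes w≤v = v , ≤-trans (∣p∪q∣≤∣p∣+∣q∣ (F w) _) (+-mono-≤ w≤v ⋃≤)
...   | no  w≰v = w , ≤-trans (∣p∪q∣≤∣p∣+∣q∣ (F w) _)
                             (+-monoʳ-≤ ∣ F w ∣ (≤-trans ⋃≤ (*-monoʳ-≤ (length vs) (<⇒≤ (≰⇒> w≰v)))))

module _ {X : Set} (_≟_ : DecidableEquality X) where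

  fibre : ∀ {n} → Subset n → (Fin n → X) → X → Subset n
  fibre A g v = A ∩ tabulate (does ∘ (λ x → g x ≟ v))

  ∈fibre⁺ : ∀ {n} {A : Subset n} {g x} → x ∈ A → x ∈ fibre A g (g x)
  ∈fibre⁺ {g = g} x∈A = x∈p∩q⁺ (x∈A , ∈tabulate⁺ (λ x′ → g x′ ≟ g _) refl)

  ∈fibre⁻ : ∀ {n} {A : Subset n} {g v x} → x ∈ fibre A g v → x ∈ A × g x ≡ v
  ∈fibre⁻ {A = A} {g} {v} x∈ with x∈p∩q⁻ A _ x∈
  ... | x∈A , x∈g⁻¹v = x∈A , ∈tabulate⁻ (λ x′ → g x′ ≟ v) x∈g⁻¹v

  pigeonhole : ∀ {n} → X → (vs : List X) (A : Subset n) (g : Fin n → X) → (∀ x → x ∈ A → g x ∈ˡ vs) →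
               ∃[ v ] ∣ A ∣ ≤ length vs * ∣ fibre A g v ∣
  pigeonhole v₀ vs A g g∈vs with ∣⋃∣≤length*largest (fibre A g) v₀ vs
  ... | v , ⋃≤ = v , ≤-trans (p⊆q⇒∣p∣≤∣q∣ (λ x∈A → ∈⋃⁺ (fibre A g) vs (g∈vs _ x∈A) (∈fibre⁺ x∈A))) ⋃≤

  pigeonhole-many : ∀ {n} m → X → (vs : List X) (A : Subset n) (g : Fin m → Fin n → X) →
                    (∀ i x → x ∈ A → g i x ∈ˡ vs) →
                    Σ (Subset n) λ B → Σ (Fin m → X) λ v →
                      B ⊆ A × (∀ i x → x ∈ B → g i x ≡ v i) × ∣ A ∣ ≤ length vs ^ m * ∣ B ∣
  pigeonhole-many zero v₀ vs A g g∈vs = A , (λ ()) , (λ x∈A → x∈A) , (λ ()) , ≤-reflexive (sym (+-identityʳ ∣ A ∣))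
  pigeonhole-many (suc m) v₀ vs A g g∈vs with pigeonhole v₀ vs A (g Fin.zero) (g∈vs Fin.zero)
  ... | v , A≤ with pigeonhole-many m v₀ vs (fibre A (g Fin.zero) v) (g ∘ Fin.suc)
                     (λ i x x∈ → g∈vs (Fin.suc i) x (proj₁ (∈fibre⁻ x∈)))
  ...   | B , w , B⊆ , B-const , fibre≤ =
    B , v Vector.∷ w , proj₁ ∘ ∈fibre⁻ ∘ B⊆ , const , bound
    where
    const : ∀ i x → x ∈ B → g i x ≡ (v Vector.∷ w) i
    const Fin.zero    x x∈B = proj₂ (∈fibre⁻ (B⊆ x∈B))
    const (Fin.suc i) x x∈B = B-const i x x∈B
    L : ℕ
    L = length vs
    bound : ∣ A ∣ ≤ L ^ suc m * ∣ B ∣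
    bound = ≤-trans A≤ (≤-trans (*-monoʳ-≤ L fibre≤) (≤-reflexive (sym (*-assoc L (L ^ m) ∣ B ∣))))

-- Finite sequences

⪯-trans : ∀ {u v w : Seq} → u ⪯ v → v ⪯ w → u ⪯ w
⪯-trans = Prefix.trans trans

⪯-comparable : ∀ {u v w : Seq} → u ⪯ w → v ⪯ w → u ⪯ v ⊎ v ⪯ u
⪯-comparable []         _          = inj₁ []
⪯-comparable (_ ∷ _)    []         = inj₂ []
⪯-comparable (refl ∷ p) (refl ∷ q) with ⪯-comparable p q
... | inj₁ p⪯q = inj₁ (refl ∷ p⪯q)
... | inj₂ q⪯p = inj₂ (refl ∷ q⪯p)

⪯-take : ∀ {u w : Seq} l → u ⪯ w → length u ≤ l → u ⪯ take l w
⪯-take {u} l u⪯w u≤l = subst (_⪯ take l _) (take-all l u u≤l) (Prefix.take⁺ l u⪯w)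

length-∷ʳ : ∀ (u : Seq) k → length (u ∷ʳ k) ≡ suc (length u)
length-∷ʳ u k = trans (length-++ u) (+-comm (length u) 1)

replicate-∷ʳ : ∀ {A : Set} d (x : A) → replicate d x ∷ʳ x ≡ replicate (suc d) x
replicate-∷ʳ zero    x = refl
replicate-∷ʳ (suc d) x = cong (x ∷_) (replicate-∷ʳ d x)

-- Entries past the end read as 0.
_‼_ : Seq → ℕ → ℕ
[]      ‼ _     = 0
(x ∷ w) ‼ zero  = x
(x ∷ w) ‼ suc n = w ‼ n

‼-child : ∀ u k w → (u ∷ʳ k) ⪯ w → w ‼ length u ≡ k
‼-child []      k (_ ∷ w) (refl ∷ _)  = refl
‼-child (_ ∷ u) k (_ ∷ w) (refl ∷ uk⪯w) = ‼-child u k w uk⪯w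

length-concatMap-≤ : ∀ {A B : Set} (f : A → List B) {c} xs → (∀ x → length (f x) ≤ c) →
                     length (concatMap f xs) ≤ length xs * c
length-concatMap-≤ f []       _ = z≤n
length-concatMap-≤ f (x ∷ xs) f≤c =
  ≤-trans (≤-reflexive (length-++ (f x))) (+-mono-≤ (f≤c x) (length-concatMap-≤ f xs f≤c))

boundedSeqs : (R l : ℕ) → List Seq
boundedSeqs R zero    = [] ∷ []
boundedSeqs R (suc l) = [] ∷ concatMap (λ x → map (x ∷_) (boundedSeqs R l)) (upTo R)

∈boundedSeqs : ∀ R l {w : Seq} → length w ≤ l → All (_< R) w → w ∈ˡ boundedSeqs R l
∈boundedSeqs R zero    {[]}    _         _          = here refl
∈boundedSeqs R (suc l) {[]}    _         _          = here refl
∈boundedSeqs R (suc l) {x ∷ w} (s≤s w≤l) (x<R ∷ w<R) =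
  there (∈-concatMap⁺ _ (lose (∈-upTo⁺ x<R) (∈-map⁺ (x ∷_) (∈boundedSeqs R l w≤l w<R))))

length-boundedSeqs : ∀ R l → length (boundedSeqs R l) ≤ suc R ^ l
length-boundedSeqs R zero    = ≤-refl
length-boundedSeqs R (suc l) = +-mono-≤ (m^n>0 (suc R) l) (begin
  length (concatMap extend (upTo R)) ≤⟨ length-concatMap-≤ extend (upTo R) length-extend ⟩
  length (upTo R) * suc R ^ l        ≡⟨ cong (_* suc R ^ l) (length-upTo R) ⟩
  R * suc R ^ l                      ∎)
  where
  open ≤-Reasoning
  extend : ℕ → List Seq
  extend x = map (x ∷_) (boundedSeqs R l)
  length-extend : ∀ x → length (extend x) ≤ suc R ^ l
  length-extend x = ≤-trans (≤-reflexive (length-map (x ∷_) (boundedSeqs R l))) (length-boundedSeqs R l)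

-- Coding finite sequences by numbers

incHead : Seq → Seq
incHead []      = []
incHead (x ∷ w) = suc x ∷ w

decodeᵇ : ℕᵇ → Seq
decodeᵇ ℕᵇ.zero   = []
decodeᵇ 2[1+ b ]  = 0 ∷ decodeᵇ b
decodeᵇ 1+[2 b ]  = incHead (decodeᵇ b)

decode : ℕ → Seq
decode m = decodeᵇ (ℕᵇ.fromℕ m)

odds : ℕ → ℕᵇ → ℕᵇ
odds zero    b = b
odds (suc x) b = 1+[2 odds x b ]

decodeᵇ-odds-zero : ∀ j → decodeᵇ (odds j ℕᵇ.zero) ≡ []
decodeᵇ-odds-zero zero    = refl
decodeᵇ-odds-zero (suc j) = cong incHead (decodeᵇ-odds-zero j)

decodeᵇ-odds-2[1+] : ∀ x b → decodeᵇ (odds x 2[1+ b ]) ≡ x ∷ decodeᵇ b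
decodeᵇ-odds-2[1+] zero    b = refl
decodeᵇ-odds-2[1+] (suc x) b = cong incHead (decodeᵇ-odds-2[1+] x b)

toℕ-odds-≥ˡ : ∀ x b → x ≤ ℕᵇ.toℕ (odds x b)
toℕ-odds-≥ˡ zero    b = z≤n
toℕ-odds-≥ˡ (suc x) b = s≤s (≤-trans (toℕ-odds-≥ˡ x b) (m≤m+n _ _))

toℕ-odds-≥ʳ : ∀ x b → ℕᵇ.toℕ b ≤ ℕᵇ.toℕ (odds x b)
toℕ-odds-≥ʳ zero    b = ≤-refl
toℕ-odds-≥ʳ (suc x) b = m≤n⇒m≤1+n (≤-trans (toℕ-odds-≥ʳ x b) (m≤m+n _ _))

-- The j leading digits 1 decode to nothing; they make the preimage as large as we like.
encodeᵇ : Seq → ℕ → ℕᵇ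
encodeᵇ []      j = odds j ℕᵇ.zero
encodeᵇ (x ∷ w) j = odds x 2[1+ encodeᵇ w j ]

decodeᵇ-encodeᵇ : ∀ w j → decodeᵇ (encodeᵇ w j) ≡ w
decodeᵇ-encodeᵇ []      j = decodeᵇ-odds-zero j
decodeᵇ-encodeᵇ (x ∷ w) j = trans (decodeᵇ-odds-2[1+] x (encodeᵇ w j)) (cong (x ∷_) (decodeᵇ-encodeᵇ w j))

toℕ-encodeᵇ-≥ : ∀ w j → j ≤ ℕᵇ.toℕ (encodeᵇ w j)
toℕ-encodeᵇ-≥ []      j = toℕ-odds-≥ˡ j ℕᵇ.zero
toℕ-encodeᵇ-≥ (x ∷ w) j = ≤-trans (toℕ-encodeᵇ-≥ w j)
                           (≤-trans (≤-trans (n≤1+n _) (m≤m+n _ _)) (toℕ-odds-≥ʳ x 2[1+ encodeᵇ w j ]))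

decode-onto : ∀ w j → ∃[ m ] (j ≤ m × decode m ≡ w)
decode-onto w j = ℕᵇ.toℕ (encodeᵇ w j) , toℕ-encodeᵇ-≥ w j ,
                  trans (cong decodeᵇ (ℕᵇ.fromℕ-toℕ (encodeᵇ w j))) (decodeᵇ-encodeᵇ w j)

-- The forcing

baseFor : (ℓ p : ℕ) → ℕ
baseFor ℓ p = 2 + (suc p ^ ℓ + ℓ * p)

-- The entries of the nodes of length ≤ ℓ of the tree lie below P ℓ, as the splitting at length ℓ is at
-- most width ℓ. base ℓ exceeds both (1 + P ℓ) ^ ℓ, which bounds the number of truncations to length ℓ,
-- and ℓ * P ℓ, which bounds the successor counts in the arrow argument.
P : ℕ → ℕ
P zero    = 1
P (suc ℓ) = P ℓ + baseFor ℓ (P ℓ) ^ (ℓ * (2 + ℓ))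

base : ℕ → ℕ
base ℓ = baseFor ℓ (P ℓ)

width : ℕ → ℕ
width ℓ = base ℓ ^ (ℓ * (2 + ℓ))

1<base : ∀ ℓ → 1 < base ℓ
1<base ℓ = s≤s (s≤s z≤n)

P>0 : ∀ ℓ → 0 < P ℓ
P>0 zero    = z<s
P>0 (suc ℓ) = ≤-trans (P>0 ℓ) (m≤m+n _ _)

P-mono-≤ : ∀ {ℓ ℓ′} → ℓ ≤ ℓ′ → P ℓ ≤ P ℓ′
P-mono-≤ {ℓ} {ℓ′} ℓ≤ℓ′ with m≤n⇒m<n∨m≡n ℓ≤ℓ′
... | inj₂ refl = ≤-refl
P-mono-≤ {ℓ} {suc ℓ′} _ | inj₁ (s≤s ℓ≤ℓ′) = ≤-trans (P-mono-≤ ℓ≤ℓ′) (m≤m+n _ _)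

*P<base : ∀ ℓ → ℓ * P ℓ < base ℓ
*P<base ℓ = s≤s (≤-trans (m≤n+m (ℓ * P ℓ) (suc (P ℓ) ^ ℓ)) (n≤1+n _))

^≤base : ∀ ℓ → suc (P ℓ) ^ ℓ ≤ base ℓ
^≤base ℓ = ≤-trans (m≤m+n _ _) (≤-trans (n≤1+n _) (n≤1+n _))

-- The only candidate for a splitting node of length ℓ; there is none when decode ℓ is longer than ℓ.
active : ℕ → Seq
active ℓ = decode ℓ ++ replicate (ℓ ∸ length (decode ℓ)) 0

Active : Seq → Set
Active u = u ≡ active (length u)

active? : ∀ u → Dec (Active u)
active? u = ≡-dec _≟_ u (active (length u))

sp : Splitting
sp u = if does (active? u) then width (length u) else 1

weight : (u : Seq) → Subset (sp u) → ℕ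
weight u A = digits (base (length u)) ∣ A ∣

μ : Measure sp
μ u A = + weight u A / suc (suc (length u))

sp-active : ∀ {u} → Active u → sp u ≡ width (length u)
sp-active {u} act rewrite dec-true (active? u) act = refl

sp-inactive : ∀ {u} → ¬ Active u → sp u ≡ 1
sp-inactive {u} ¬act rewrite dec-false (active? u) ¬act = refl

active-unique : ∀ {u v} → Active u → Active v → length u ≡ length v → u ≡ v
active-unique act-u act-v lu≡lv = trans act-u (trans (cong active lu≡lv) (sym act-v))

sp>0 : ∀ u → 0 < sp u
sp>0 u with active? u
... | yes act = m^n>0 (base (length u)) (length u * (2 + length u))
... | no  _   = z<s

sp≤P : ∀ u → sp u ≤ P (suc (length u))
sp≤P u with active? u
... | yes _ = m≤n+m _ _
... | no  _ = ≤-trans (P>0 (length u)) (m≤m+n _ _)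

wide⇒active : ∀ {u} → 2 ≤ sp u → Active u
wide⇒active {u} 2≤sp with active? u
... | yes act = act
... | no  _   with s≤s () ← 2≤sp

μ-small : ∀ u (A : Subset (sp u)) {m} → ∣ A ∣ < base (length u) → m ≤ length u → μ u A ℚ.< + 1 / suc m
μ-small u A {m} A<base m≤ℓ = /-< (weight u A) 1 (suc ℓ) m (begin-strict
  weight u A * suc m            ≤⟨ *-monoˡ-≤ (suc m) (digits-<β (1<base ℓ) A<base) ⟩
  1 * suc m                     <⟨ *-monoʳ-< 1 (s≤s (s≤s m≤ℓ)) ⟩
  1 * suc (suc ℓ)               ∎)
  where
  ℓ : ℕ
  ℓ = length u
  open ≤-Reasoning

μ-large : ∀ u (A : Subset (sp u)) K → K * suc (suc (length u)) < weight u A → ℕtoℚ K ℚ.< μ u A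
μ-large u A K K<w = /-< K (weight u A) 0 (suc (length u)) (≤-trans K<w (≤-reflexive (sym (*-identityʳ _))))

μ-large⁻¹ : ∀ u (A : Subset (sp u)) K → ℕtoℚ K ℚ.< μ u A → K * suc (suc (length u)) < weight u A
μ-large⁻¹ u A K K<μ = ≤-trans (/-<⁻¹ K (weight u A) 0 (suc (length u)) K<μ) (≤-reflexive (*-identityʳ _))

μ-active : ∀ u K → Active u → K ≤ length u → ℕtoℚ K ℚ.< μ u ⊤
μ-active u K act K≤ℓ = μ-large u (⊤ {sp u}) K (begin-strict
  K * suc (suc ℓ)             ≤⟨ *-monoˡ-≤ (suc (suc ℓ)) K≤ℓ ⟩
  ℓ * suc (suc ℓ)             <⟨ β^≤⇒<digits (1<base ℓ) ≤-refl ⟩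
  digits (base ℓ) (width ℓ)   ≡⟨ cong (digits (base ℓ)) (sym (trans (∣⊤∣≡n (sp u)) (sp-active act))) ⟩
  weight u ⊤                  ∎)
  where
  ℓ : ℕ
  ℓ = length u
  open ≤-Reasoning

μ-nonneg : ∀ u (A : Subset (sp u)) → 0ℚ ℚ.≤ μ u A
μ-nonneg u A = /-≤ 0 (weight u A) 0 (suc (length u)) z≤n

μ-monotone : ∀ u (A B : Subset (sp u)) → A ⊆ B → μ u A ℚ.≤ μ u B
μ-monotone u A B A⊆B = /-≤ (weight u A) (weight u B) (suc ℓ) (suc ℓ)
  (*-monoˡ-≤ (suc (suc ℓ)) (digits-mono-≤ (1<base ℓ) (p⊆q⇒∣p∣≤∣q∣ A⊆B)))
  where
  ℓ : ℕ
  ℓ = length u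

μ-singleton : ∀ u (k : Fin (sp u)) → μ u ⁅ k ⁆ ℚ.< 1ℚ
μ-singleton u k = μ-small u ⁅ k ⁆ (subst (_< base (length u)) (sym (∣⁅x⁆∣≡1 k)) (1<base (length u))) z≤n

μ-subadditive : ∀ u (A B : Subset (sp u)) → μ u (A ∪ B) ℚ.≤ μ u A ℚ.+ μ u B
μ-subadditive u A B = /-subadditive (weight u (A ∪ B)) (weight u A) (weight u B) (suc ℓ)
  (≤-trans (digits-mono-≤ (1<base ℓ) (∣p∪q∣≤∣p∣+∣q∣ A B)) (digits-+ (1<base ℓ) ∣ A ∣ ∣ B ∣))
  where
  ℓ : ℕ
  ℓ = length u

-- Branches

restr-suc : ∀ b m → restr b (suc m) ≡ restr b m ∷ʳ b m
restr-suc b zero    = refl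
restr-suc b (suc m) = cong (b 0 ∷_) (restr-suc (b ∘ suc) m)

length-restr : ∀ b m → length (restr b m) ≡ m
length-restr b m = length-tabulate _

module _ {b : ℕ → ℕ} (b∈ : Branch sp b) where

  inactive⇒0 : ∀ m → ¬ Active (restr b m) → b m ≡ 0
  inactive⇒0 m ¬act = n<1⇒n≡0 (subst (b m <_) (sp-inactive ¬act) (b∈ m))

  zeros-until-active : ∀ n d → (∃[ j ] (n ≤ j × Active (restr b j))) ⊎ restr b (n + d) ≡ restr b n ++ replicate d 0
  zeros-until-active n zero    = inj₂ (trans (cong (restr b) (+-identityʳ n)) (sym (++-identityʳ (restr b n))))
  zeros-until-active n (suc d) with zeros-until-active n d | active? (restr b (n + d))
  ... | inj₁ found  | _       = inj₁ found
  ... | inj₂ _      | yes act = inj₁ (n + d , m≤m+n n d , act)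
  ... | inj₂ zeros  | no ¬act = inj₂ (begin
    restr b (n + suc d)                    ≡⟨ cong (restr b) (+-suc n d) ⟩
    restr b (suc (n + d))                  ≡⟨ restr-suc b (n + d) ⟩
    restr b (n + d) ∷ʳ b (n + d)           ≡⟨ cong₂ _∷ʳ_ zeros (inactive⇒0 (n + d) ¬act) ⟩
    (restr b n ++ replicate d 0) ∷ʳ 0      ≡⟨ ++-assoc (restr b n) (replicate d 0) (0 ∷ []) ⟩
    restr b n ++ (replicate d 0 ∷ʳ 0)      ≡⟨ cong (restr b n ++_) (replicate-∷ʳ d 0) ⟩
    restr b n ++ replicate (suc d) 0       ∎)
    where open ≡-Reasoning

  meets-active : ∀ n → ∃[ j ] (n ≤ j × Active (restr b j))
  meets-active n with decode-onto (restr b n) n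
  ... | m , n≤m , decode-m with zeros-until-active n (m ∸ n)
  ...   | inj₁ found = found
  ...   | inj₂ zeros = m , n≤m , trans (cong (restr b) (sym (m+[n∸m]≡n n≤m))) (trans zeros padded)
    where
    padded : restr b n ++ replicate (m ∸ n) 0 ≡ active (length (restr b m))
    padded = trans (cong₂ (λ w l → w ++ replicate (m ∸ l) 0) (sym decode-m)
                          (trans (sym (length-restr b n)) (cong length (sym decode-m))))
                   (cong active (sym (length-restr b m)))

  μ-limsup-∞ : ∀ K n → ∃[ m ] (m ≥ n × ℕtoℚ K ℚ.< μ (restr b m) ⊤)
  μ-limsup-∞ K n = conclude (meets-active (n + K))
    where
    conclude : ∃[ j ] (n + K ≤ j × Active (restr b j)) → ∃[ m ] (m ≥ n × ℕtoℚ K ℚ.< μ (restr b m) ⊤)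
    conclude (m , n+K≤m , act) = m , ≤-trans (m≤m+n n K) n+K≤m ,
      μ-active (restr b m) K act (subst (K ≤_) (sym (length-restr b m)) (≤-trans (m≤n+m K n) n+K≤m))

-- The arrow property

take-entries<P : ∀ l {p w} → inTree' sp p w → All (_< P (length p + l)) (take l w)
take-entries<P zero    _ = []
take-entries<P (suc l) {p} {[]}    _ = []
take-entries<P (suc l) {p} {x ∷ w} (x<sp , w∈) =
  <-≤-trans x<sp (≤-trans (sp≤P p) (P-mono-≤ 1+p≤p+1+l)) ∷
  subst (λ n → All (_< P n) (take l w)) p∷ʳx+l≡ (take-entries<P l w∈)
  where
  1+p≤p+1+l : suc (length p) ≤ length p + suc l
  1+p≤p+1+l = ≤-trans (m≤m+n (suc (length p)) l) (≤-reflexive (sym (+-suc (length p) l)))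
  p∷ʳx+l≡ : length (p ∷ʳ x) + l ≡ length p + suc l
  p∷ʳx+l≡ = trans (cong (_+ l) (length-∷ʳ p x)) (sym (+-suc (length p) l))

module ArrowProof (m : ℕ) (s : Fin (suc m) → Seq) (t : Seq) (s⊥t : ∀ i → s i ⊥ t)
                  (A : Subset (sp t)) (A-large : ℕtoℚ (suc m + suc m) ℚ.< μ t A)
                  (f : Fin (suc m) → Fin (sp t) → Seq)
                  (f∈ : ∀ i k → k ∈ A → InTree sp (f i k) × (f i k ⪯ s i ⊎ s i ⪯ f i k)) where

  M N ℓ D : ℕ
  M = suc m
  N = M + M
  ℓ = length t
  D = suc (suc ℓ)

  N*D<weight-A : N * D < weight t A
  N*D<weight-A = μ-large⁻¹ t A N A-large

  t-active : Active t
  t-active = wide⇒active (begin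
    2              ≤⟨ 1<base ℓ ⟩
    base ℓ         ≡⟨ sym (*-identityʳ (base ℓ)) ⟩
    base ℓ ^ 1     ≤⟨ <digits⇒β^≤ (1<base ℓ) (≤-<-trans (s≤s z≤n) N*D<weight-A) ⟩
    ∣ A ∣          ≤⟨ ∣p∣≤n A ⟩
    sp t           ∎)
    where open ≤-Reasoning

  truncation : Fin M → Fin (sp t) → Seq
  truncation i x = take ℓ (f i x)

  truncation∈ : ∀ i x → x ∈ A → truncation i x ∈ˡ boundedSeqs (P ℓ) ℓ
  truncation∈ i x x∈A = ∈boundedSeqs (P ℓ) ℓ (≤-trans (≤-reflexive (length-take ℓ (f i x))) (m⊓n≤m ℓ _))
                                            (take-entries<P ℓ (proj₁ (f∈ i x x∈A)))

  μ-refinement : ∀ B → ∣ A ∣ ≤ length (boundedSeqs (P ℓ) ℓ) ^ M * ∣ B ∣ → ℕtoℚ M ℚ.< μ t B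
  μ-refinement B A≤ = μ-large t B M (+-cancelˡ-< M (M * D) (weight t B) (begin-strict
    M + M * D                            ≤⟨ +-monoˡ-≤ (M * D) (m≤m*n M D) ⟩
    M * D + M * D                        ≡⟨ sym (*-distribʳ-+ D M M) ⟩
    N * D                                <⟨ N*D<weight-A ⟩
    weight t A                           ≤⟨ digits-mono-≤ (1<base ℓ) A≤base^M*B ⟩
    digits (base ℓ) (base ℓ ^ M * ∣ B ∣)  ≤⟨ digits-β^* (1<base ℓ) M ∣ B ∣ ⟩
    M + weight t B                       ∎))
    where
    open ≤-Reasoning
    A≤base^M*B : ∣ A ∣ ≤ base ℓ ^ M * ∣ B ∣
    A≤base^M*B = ≤-trans A≤ (*-monoˡ-≤ ∣ B ∣ (^-monoˡ-≤ M (≤-trans (length-boundedSeqs (P ℓ) ℓ) (^≤base ℓ))))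

  module Refined (B : Subset (sp t)) (v : Fin M → Seq) (B⊆A : B ⊆ A)
                 (truncation≡v : ∀ i x → x ∈ B → truncation i x ≡ v i) where

    Gen : Seq → Set
    Gen = Generated M (sp t) B f

    Gen? : ∀ w → Dec (Gen w)
    Gen? = Generated? M (sp t) B f

    Succ : (u : Seq) → Subset (sp u)
    Succ = SuccOf sp Gen Gen?

    ∈Succ⁻ : ∀ {u k} → k ∈ Succ u → ∃[ i ] ∃[ x ] (x ∈ B × (u ∷ʳ toℕ k) ⪯ f i x)
    ∈Succ⁻ {u} = ∈tabulate⁻ (λ k → Gen? (u ∷ʳ toℕ k))

    t∉Gen : ¬ Gen t
    t∉Gen (i , x , x∈B , t⪯fx) with proj₂ (f∈ i x (B⊆A x∈B))
    ... | inj₁ fx⪯si = proj₂ (s⊥t i) (⪯-trans t⪯fx fx⪯si)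
    ... | inj₂ si⪯fx with ⪯-comparable t⪯fx si⪯fx
    ...   | inj₁ t⪯si = proj₂ (s⊥t i) t⪯si
    ...   | inj₂ si⪯t = proj₁ (s⊥t i) si⪯t

    -- Below level ℓ the branches of the f i x (x ∈ B) follow the M sequences v i.
    Succ-short : ∀ u → length u < ℓ → ∣ Succ u ∣ ≤ M
    Succ-short u u<ℓ = ≤-trans (p⊆q⇒∣p∣≤∣q∣ Succ⊆) (∣imageℕ∣≤ {sp u} (λ i → v i ‼ length u))
      where
      Succ⊆ : Succ u ⊆ imageℕ (λ i → v i ‼ length u)
      Succ⊆ {k} k∈ with ∈Succ⁻ k∈
      ... | i , x , x∈B , uk⪯fx = ∈imageℕ (λ i → v i ‼ length u) i (‼-child u (toℕ k) (v i)
            (subst ((u ∷ʳ toℕ k) ⪯_) (truncation≡v i x x∈B)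
                   (⪯-take ℓ uk⪯fx (≤-trans (≤-reflexive (length-∷ʳ u (toℕ k))) u<ℓ))))

    Succ-long : ∀ u → ℓ < length u → ∣ Succ u ∣ ≤ M * sp t
    Succ-long u ℓ<u = ≤-trans (p⊆q⇒∣p∣≤∣q∣ Succ⊆) (∣imageℕ∣≤ {sp u} e)
      where
      e : Fin (M * sp t) → ℕ
      e j = uncurry f (remQuot (sp t) j) ‼ length u
      Succ⊆ : Succ u ⊆ imageℕ e
      Succ⊆ {k} k∈ with ∈Succ⁻ k∈
      ... | i , x , _ , uk⪯fx = ∈imageℕ e (combine i x)
            (trans (cong (λ ix → uncurry f ix ‼ length u) (remQuot-combine i x)) (‼-child u (toℕ k) (f i x) uk⪯fx))

    Succ-level : ∀ u → Gen u → length u ≡ ℓ → ∣ Succ u ∣ ≤ 1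
    Succ-level u u∈Gen u≡ℓ = ≤-trans (∣p∣≤n (Succ u)) (≤-reflexive (sp-inactive ¬act))
      where
      ¬act : ¬ Active u
      ¬act act = t∉Gen (subst Gen (active-unique act t-active u≡ℓ) u∈Gen)

    Succ-small : ∀ u → Gen u → N ≤ length u → ∣ Succ u ∣ < base (length u)
    Succ-small u u∈Gen N≤u = ≤-<-trans (count (<-cmp (length u) ℓ)) (*P<base (length u))
      where
      M≤u : M ≤ length u
      M≤u = ≤-trans (m≤m+n M M) N≤u
      count : Tri (length u < ℓ) (length u ≡ ℓ) (ℓ < length u) → ∣ Succ u ∣ ≤ length u * P (length u)
      count (tri< u<ℓ _ _) =
        ≤-trans (Succ-short u u<ℓ) (≤-trans M≤u (m≤m*n (length u) (P (length u)) {{>-nonZero (P>0 (length u))}}))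
      count (tri> _ _ ℓ<u) = ≤-trans (Succ-long u ℓ<u) (*-mono-≤ M≤u (≤-trans (sp≤P t) (P-mono-≤ ℓ<u)))
      count (tri≈ _ u≡ℓ _) = ≤-trans (Succ-level u u∈Gen u≡ℓ) (*-mono-≤ (≤-trans (s≤s z≤n) M≤u) (P>0 (length u)))

    meager : Meager sp μ Gen Gen? N (+ 1 / M)
    meager u u∈Gen N≤u = μ-small u (Succ u) (Succ-small u u∈Gen N≤u) (≤-trans (n≤1+n m) (≤-trans (m≤m+n M M) N≤u))

  Witness : Set
  Witness = ∃[ B ] (B ⊆ A × ℕtoℚ M ℚ.< μ t B ×
                    Meager sp μ (Generated M (sp t) B f) (Generated? M (sp t) B f) N (+ 1 / M))

  witness : Witness
  witness = conclude (pigeonhole-many (≡-dec _≟_) M [] (boundedSeqs (P ℓ) ℓ) A truncation truncation∈)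
    where
    conclude : Σ (Subset (sp t)) (λ B → Σ (Fin M → Seq) λ v → B ⊆ A × (∀ i x → x ∈ B → truncation i x ≡ v i) ×
                                         ∣ A ∣ ≤ length (boundedSeqs (P ℓ) ℓ) ^ M * ∣ B ∣) → Witness
    conclude (B , v , B⊆A , truncation≡v , A≤) = B , B⊆A , μ-refinement B A≤ , Refined.meager B v B⊆A truncation≡v

arrow : ∀ M → .{{_ : NonZero M}} → ∃[ N ] Arrow sp μ N M
arrow (suc m) = suc m + suc m , λ s _ t _ s⊥t A A-large f f∈ →
  ArrowProof.witness m s t s⊥t A A-large f f∈

isLimSupTreeForcing : IsLimSupTreeForcing sp μ
isLimSupTreeForcing = record
  { pruned    = λ t _ → >-nonZero (sp>0 t)
  ; nonneg    = λ t _ → μ-nonneg t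
  ; monotone  = λ t _ → μ-monotone t
  ; singleton = λ t _ → μ-singleton t
  ; limsup-∞  = λ b b∈ → μ-limsup-∞ {b} b∈
  }

stronglyNonHomogeneous : StronglyNonHomogeneous sp μ
stronglyNonHomogeneous = record
  { subadditive = λ t _ → μ-subadditive t
  ; arrow       = arrow
  }

lemma6p5 : ∃[ sp ] ∃[ μ ] (IsLimSupTreeForcing sp μ × StronglyNonHomogeneous sp μ)
lemma6p5 = sp , μ , isLimSupTreeForcing , stronglyNonHomogeneous
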